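{- Let $n\ge1$ and let $\lambda=(\lambda_1,\ldots,\lambda_k)$ be a composition of $n$. The number of $\lambda$-unimodal permutations in $\mathcal{S}_n$ is \[\frac{n!}{\lambda_1!\lambda_2!\cdots\lambda_k!}\,2^{n-k}.\]
   Context: $\mathcal{S}_n$ is the set of permutations of $[n]=\{1,\ldots,n\}$, written in one-line notation $\pi=\pi_1\cdots\pi_n$. A composition of $n$ is a sequence of positive integers summing to $n$. A sequence is unimodal if it is strictly increasing and then strictly decreasing. A permutation $\pi\in\mathcal{S}_n$ is $\lambda$-unimodal if, when its one-line notation is cut into $k$ consecutive segments of lengths $\lambda_1,\ldots,\lambda_k$, each segment is unimodal. -}

module Defs where

open import Data.Nat using (ℕ; zero; suc; _<ᵇ_; _<_; _*_; _^_; _∸_; _/_; NonZero)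
open import Data.Nat using (_!)
open import Data.List.Relation.Unary.All using (All)
open import Data.Product using (_×_)
open import Relation.Binary.PropositionalEquality using (_≡_)
open import Relation.Nullary.Decidable.Core using (T?)
open import Data.Bool using (Bool; true; false; _∧_; if_then_else_)
open import Data.List using (List; []; _∷_; length; map; filter; concatMap; take; drop; upTo)
open import Data.Nat.ListAction using (sum; product)
open import Data.Nat using (_≡ᵇ_)

decreasingᵇ : List ℕ → Bool
decreasingᵇ (x ∷ y ∷ r) = (y <ᵇ x) ∧ decreasingᵇ (y ∷ r)
decreasingᵇ _ = true

unimodalᵇ : List ℕ → Bool
unimodalᵇ (x ∷ y ∷ r) = if x <ᵇ y then unimodalᵇ (y ∷ r) else decreasingᵇ (x ∷ y ∷ r)
unimodalᵇ _ = true

allᵇ : {A : Set} → (A → Bool) → List A → Bool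
allᵇ p [] = true
allᵇ p (x ∷ xs) = p x ∧ allᵇ p xs

segments : List ℕ → List ℕ → List (List ℕ)
segments [] xs = []
segments (l ∷ ls) xs = take l xs ∷ segments ls (drop l xs)

λ-unimodalᵇ : List ℕ → List ℕ → Bool
λ-unimodalᵇ lam π = allᵇ unimodalᵇ (segments lam π)

IsComposition : ℕ → List ℕ → Set
IsComposition n lam = All (λ l → 0 < l) lam × sum lam ≡ n

words : List ℕ → ℕ → List (List ℕ)
words xs zero = [] ∷ []
words xs (suc m) = concatMap (λ w → map (λ x → x ∷ w) xs) (words xs m)

oneTo : ℕ → List ℕ
oneTo n = map suc (upTo n)

countᵇ : ℕ → List ℕ → ℕ
countᵇ x [] = 0
countᵇ x (y ∷ ys) = if x ≡ᵇ y then suc (countᵇ x ys) else countᵇ x ys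

isPermᵇ : ℕ → List ℕ → Bool
isPermᵇ n w = allᵇ (λ i → countᵇ i w ≡ᵇ 1) (oneTo n)

-- S_n, in one-line notation
Sₙ : ℕ → List (List ℕ)
Sₙ n = filter (λ w → T? (isPermᵇ n w)) (words (oneTo n) n)

numUnimodal : ℕ → List ℕ → ℕ
numUnimodal n lam = length (filter (λ π → T? (λ-unimodalᵇ lam π)) (Sₙ n))

-- A λ-unimodal arrangement of n letters is built block by block: the first block is a
-- unimodal word of λ₁ distinct letters and the rest is a λ-unimodal arrangement of the
-- letters left over. The number of unimodal words of length l ≥ 1 with distinct letters
-- from an N-element set is C(N,l) 2^(l-1): such a word splits into an increasing prefix
-- and a decreasing suffix in exactly two ways (the peak belongs to either part), and
-- an increasing (or decreasing) word of length i is just an i-subset, so twice the count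
-- is Σᵢ C(N,i) C(N-i,l-i) = C(N,l) 2^l. Multiplying over the blocks gives the formula.
module Submission where

import Algebra.Properties.CommutativeSemigroup as CommutativeSemigroupProperties
open import Data.Bool using (Bool; true; false; _∧_; _∨_; if_then_else_)
open import Data.Bool.Properties using (∧-zeroʳ)
open import Data.List using (List; []; _∷_; length; map; _++_; take; drop; filter; concatMap; upTo; applyUpTo)
open import Data.List.Properties using (length-map; length-upTo; map-upTo)
open import Data.List.Relation.Unary.All using (All; []; _∷_)
open import Data.Nat using (ℕ; zero; suc; _+_; _*_; _∸_; _^_; _!; _≡ᵇ_; _<ᵇ_; _≤_; _<_; z≤n; z<s; s<s)
open import Data.Nat.Combinatorics using (_C_; nCk+nC[k+1]≡[n+1]C[k+1]; k![n∸k]!∣n!)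
open import Data.Nat.Combinatorics.Specification using (nCk≡n!/k![n-k]!; k>n⇒nCk≡0)
open import Data.Nat.DivMod using (m/n*n≡m)
open import Data.Nat.ListAction using (sum; product)
open import Data.Nat.Properties
open import Data.Nat.Tactic.RingSolver using (solve-∀)
open import Data.Product using (_×_; _,_; ∃; proj₁)
open import Data.Unit using (⊤; tt)
open import Function using (flip)
open import Relation.Binary.Construct.Flip.EqAndOrd using () renaming (isStrictTotalOrder to flip-isStrictTotalOrder)
open import Relation.Binary.Definitions using (Decidable; tri<; tri≈; tri>)
open import Relation.Binary.PropositionalEquality
open import Relation.Binary.Structures using (IsStrictTotalOrder)
open import Relation.Nullary using (¬_; does; proof; yes; no; contradiction)
open import Relation.Nullary.Decidable.Core using (T?)
open import Relation.Nullary.Reflects using (Reflects; ofʸ; ofⁿ)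

open import Defs

open CommutativeSemigroupProperties +-commutativeSemigroup using () renaming (interchange to +-interchange; x∙yz≈y∙xz to +-swapˡ)
open CommutativeSemigroupProperties *-commutativeSemigroup using () renaming (x∙yz≈y∙xz to *-swapˡ)

⟦_⟧ : Bool → ℕ
⟦ true ⟧ = 1
⟦ false ⟧ = 0

⟦∧⟧ : ∀ a b → ⟦ a ∧ b ⟧ ≡ ⟦ a ⟧ * ⟦ b ⟧
⟦∧⟧ true b = sym (+-identityʳ ⟦ b ⟧)
⟦∧⟧ false b = refl

≡ᵇ-reflects-≡ : ∀ x y → Reflects (x ≡ y) (x ≡ᵇ y)
≡ᵇ-reflects-≡ x y = proof (x ≟ y)

≡ᵇ-refl : ∀ x → (x ≡ᵇ x) ≡ true
≡ᵇ-refl x with x ≡ᵇ x | ≡ᵇ-reflects-≡ x x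
... | true | _ = refl
... | false | ofⁿ x≢x = contradiction refl x≢x

<⇒<ᵇ≡true : ∀ {m n} → m < n → (m <ᵇ n) ≡ true
<⇒<ᵇ≡true {m} {n} m<n with m <ᵇ n | <ᵇ-reflects-< m n
... | true | _ = refl
... | false | ofⁿ m≮n = contradiction m<n m≮n

≮⇒<ᵇ≡false : ∀ {m n} → ¬ m < n → (m <ᵇ n) ≡ false
≮⇒<ᵇ≡false {m} {n} m≮n with m <ᵇ n | <ᵇ-reflects-< m n
... | true | ofʸ m<n = contradiction m<n m≮n
... | false | _ = refl

infix 8 _∈ᵇ_

_∈ᵇ_ : ℕ → List ℕ → Bool
x ∈ᵇ [] = false
x ∈ᵇ (y ∷ ys) = (x ≡ᵇ y) ∨ x ∈ᵇ ys

remove : ℕ → List ℕ → List ℕ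
remove x [] = []
remove x (y ∷ ys) = if x ≡ᵇ y then ys else y ∷ remove x ys

Distinct : List ℕ → Set
Distinct [] = ⊤
Distinct (x ∷ xs) = x ∈ᵇ xs ≡ false × Distinct xs

_⊆ᵇ_ : List ℕ → List ℕ → Set
xs ⊆ᵇ ys = ∀ x → x ∈ᵇ xs ≡ true → x ∈ᵇ ys ≡ true

∈ᵇ-here : ∀ x xs → x ∈ᵇ (x ∷ xs) ≡ true
∈ᵇ-here x xs = cong (_∨ x ∈ᵇ xs) (≡ᵇ-refl x)

∈ᵇ-there : ∀ x y xs → x ∈ᵇ xs ≡ true → x ∈ᵇ (y ∷ xs) ≡ true
∈ᵇ-there x y xs x∈xs with x ≡ᵇ y
... | true = refl
... | false = x∈xs

∈ᵇ-∷⁻ : ∀ x y xs → x ∈ᵇ (y ∷ xs) ≡ true → x ≢ y → x ∈ᵇ xs ≡ true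
∈ᵇ-∷⁻ x y xs x∈ x≢y with x ≡ᵇ y | ≡ᵇ-reflects-≡ x y
... | true | ofʸ x≡y = contradiction x≡y x≢y
... | false | _ = x∈

∉ᵇ-∷⁻ : ∀ {x y xs} → x ∈ᵇ (y ∷ xs) ≡ false → x ≢ y × x ∈ᵇ xs ≡ false
∉ᵇ-∷⁻ {x} {y} x∉ with x ≡ᵇ y | ≡ᵇ-reflects-≡ x y
... | false | ofⁿ x≢y = x≢y , x∉

∈ᵇ-remove⁻ : ∀ x y xs → x ∈ᵇ remove y xs ≡ true → x ∈ᵇ xs ≡ true
∈ᵇ-remove⁻ x y (z ∷ xs) x∈ with y ≡ᵇ z
... | true = ∈ᵇ-there x z xs x∈
... | false with x ≡ᵇ z
...   | true = refl
...   | false = ∈ᵇ-remove⁻ x y xs x∈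

∈ᵇ-remove-≢ : ∀ {x y} xs → x ≢ y → x ∈ᵇ remove y xs ≡ x ∈ᵇ xs
∈ᵇ-remove-≢ [] _ = refl
∈ᵇ-remove-≢ {x} {y} (z ∷ xs) x≢y with y ≡ᵇ z | ≡ᵇ-reflects-≡ y z | x ≡ᵇ z in x≟z | ≡ᵇ-reflects-≡ x z
... | true | ofʸ refl | true | ofʸ x≡y = contradiction x≡y x≢y
... | true | _ | false | _ = refl
... | false | _ | _ | _ rewrite x≟z = cong (_ ∨_) (∈ᵇ-remove-≢ xs x≢y)

∉ᵇ-remove : ∀ x xs → Distinct xs → x ∈ᵇ remove x xs ≡ false
∉ᵇ-remove x [] _ = refl
∉ᵇ-remove x (y ∷ xs) (y∉xs , xs-distinct) with x ≡ᵇ y in x≟y | ≡ᵇ-reflects-≡ x y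
... | true | ofʸ refl = y∉xs
... | false | _ rewrite x≟y = ∉ᵇ-remove x xs xs-distinct

∉ᵇ-remove⁺ : ∀ x y xs → x ∈ᵇ xs ≡ false → x ∈ᵇ remove y xs ≡ false
∉ᵇ-remove⁺ x y xs x∉xs with x ∈ᵇ remove y xs in x∈?
... | false = refl
... | true with () ← trans (sym (∈ᵇ-remove⁻ x y xs x∈?)) x∉xs

Distinct-remove : ∀ x xs → Distinct xs → Distinct (remove x xs)
Distinct-remove x [] _ = tt
Distinct-remove x (y ∷ xs) (y∉xs , xs-distinct) with x ≡ᵇ y
... | true = xs-distinct
... | false = ∉ᵇ-remove⁺ y x xs y∉xs , Distinct-remove x xs xs-distinct

length-remove : ∀ x xs → x ∈ᵇ xs ≡ true → suc (length (remove x xs)) ≡ length xs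
length-remove x (y ∷ xs) x∈ with x ≡ᵇ y
... | true = refl
... | false = cong suc (length-remove x xs x∈)

remove-∉ᵇ : ∀ x xs → x ∈ᵇ xs ≡ false → remove x xs ≡ xs
remove-∉ᵇ x [] _ = refl
remove-∉ᵇ x (y ∷ xs) x∉ with x ≡ᵇ y
... | false = cong (y ∷_) (remove-∉ᵇ x xs x∉)

remove-comm : ∀ x y xs → remove x (remove y xs) ≡ remove y (remove x xs)
remove-comm x y [] = refl
remove-comm x y (z ∷ xs) with y ≡ᵇ z in y≟z | ≡ᵇ-reflects-≡ y z | x ≡ᵇ z in x≟z | ≡ᵇ-reflects-≡ x z
... | true | ofʸ refl | true | ofʸ refl = refl
... | true | _ | false | _ rewrite y≟z = refl
... | false | _ | true | _ rewrite x≟z = refl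
... | false | _ | false | _ rewrite x≟z | y≟z = cong (z ∷_) (remove-comm x y xs)

module _ {A : Set} where

  take-++-length : ∀ {i} (xs ys : List A) → length xs ≡ i → take i (xs ++ ys) ≡ xs
  take-++-length [] ys refl = refl
  take-++-length (x ∷ xs) ys refl = cong (x ∷_) (take-++-length xs ys refl)

  drop-++-length : ∀ {i} (xs ys : List A) → length xs ≡ i → drop i (xs ++ ys) ≡ ys
  drop-++-length [] ys refl = refl
  drop-++-length (x ∷ xs) ys refl = drop-++-length xs ys refl

∑ : {A : Set} → List A → (A → ℕ) → ℕ
∑ [] f = 0
∑ (x ∷ xs) f = f x + ∑ xs f

syntax ∑ xs (λ x → e) = ∑[ x ∈ xs ] e

module _ {A : Set} where

  ∑-cong : ∀ (xs : List A) {f g : A → ℕ} → (∀ x → f x ≡ g x) → ∑ xs f ≡ ∑ xs g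
  ∑-cong [] _ = refl
  ∑-cong (x ∷ xs) f≗g = cong₂ _+_ (f≗g x) (∑-cong xs f≗g)

  ∑-zero : ∀ (xs : List A) → ∑[ x ∈ xs ] 0 ≡ 0
  ∑-zero [] = refl
  ∑-zero (x ∷ xs) = ∑-zero xs

  ∑-distrib-+ : ∀ (xs : List A) f g → ∑[ x ∈ xs ] (f x + g x) ≡ ∑ xs f + ∑ xs g
  ∑-distrib-+ [] f g = refl
  ∑-distrib-+ (x ∷ xs) f g = begin
    (f x + g x) + ∑[ y ∈ xs ] (f y + g y) ≡⟨ cong (f x + g x +_) (∑-distrib-+ xs f g) ⟩
    (f x + g x) + (∑ xs f + ∑ xs g)      ≡⟨ +-interchange (f x) (g x) _ _ ⟩
    (f x + ∑ xs f) + (g x + ∑ xs g)      ∎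
    where open ≡-Reasoning

  ∑-*ˡ : ∀ (xs : List A) c f → ∑[ x ∈ xs ] (c * f x) ≡ c * ∑ xs f
  ∑-*ˡ [] c f = sym (*-zeroʳ c)
  ∑-*ˡ (x ∷ xs) c f = trans (cong (c * f x +_) (∑-*ˡ xs c f)) (sym (*-distribˡ-+ c (f x) (∑ xs f)))

  ∑-++ : ∀ (xs ys : List A) f → ∑ (xs ++ ys) f ≡ ∑ xs f + ∑ ys f
  ∑-++ [] ys f = refl
  ∑-++ (x ∷ xs) ys f = trans (cong (f x +_) (∑-++ xs ys f)) (sym (+-assoc (f x) _ _))

  length-filter : ∀ (p : A → Bool) xs → length (filter (λ x → T? (p x)) xs) ≡ ∑[ x ∈ xs ] ⟦ p x ⟧
  length-filter p [] = refl
  length-filter p (x ∷ xs) with p x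
  ... | true = cong suc (length-filter p xs)
  ... | false = length-filter p xs

  ∑-filter : ∀ (p : A → Bool) f xs → ∑ (filter (λ x → T? (p x)) xs) f ≡ ∑[ x ∈ xs ] (⟦ p x ⟧ * f x)
  ∑-filter p f [] = refl
  ∑-filter p f (x ∷ xs) with p x
  ... | true = cong₂ _+_ (sym (+-identityʳ (f x))) (∑-filter p f xs)
  ... | false = ∑-filter p f xs

module _ {A B : Set} where

  ∑-comm : ∀ (xs : List A) (ys : List B) (f : A → B → ℕ) →
           ∑[ x ∈ xs ] ∑[ y ∈ ys ] f x y ≡ ∑[ y ∈ ys ] ∑[ x ∈ xs ] f x y
  ∑-comm [] ys f = sym (∑-zero ys)
  ∑-comm (x ∷ xs) ys f = trans (cong (∑ ys (f x) +_) (∑-comm xs ys f)) (sym (∑-distrib-+ ys (f x) _))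

  ∑-map : ∀ (g : A → B) xs f → ∑ (map g xs) f ≡ ∑[ x ∈ xs ] f (g x)
  ∑-map g [] f = refl
  ∑-map g (x ∷ xs) f = cong (f (g x) +_) (∑-map g xs f)

  ∑-concatMap : ∀ (g : A → List B) xs f → ∑ (concatMap g xs) f ≡ ∑[ x ∈ xs ] ∑ (g x) f
  ∑-concatMap g [] f = refl
  ∑-concatMap g (x ∷ xs) f = trans (∑-++ (g x) (concatMap g xs) f) (cong (∑ (g x) f +_) (∑-concatMap g xs f))

∑-cong-∈ᵇ : ∀ xs {f g : ℕ → ℕ} → (∀ x → x ∈ᵇ xs ≡ true → f x ≡ g x) → ∑ xs f ≡ ∑ xs g
∑-cong-∈ᵇ [] _ = refl
∑-cong-∈ᵇ (x ∷ xs) f≗g = cong₂ _+_ (f≗g x (∈ᵇ-here x xs)) (∑-cong-∈ᵇ xs (λ y y∈ → f≗g y (∈ᵇ-there y x xs y∈)))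

∑-remove : ∀ x xs f → x ∈ᵇ xs ≡ true → ∑ xs f ≡ f x + ∑ (remove x xs) f
∑-remove x (y ∷ xs) f x∈ with x ≡ᵇ y | ≡ᵇ-reflects-≡ x y
... | true | ofʸ refl = refl
... | false | _ = begin
  f y + ∑ xs f                  ≡⟨ cong (f y +_) (∑-remove x xs f x∈) ⟩
  f y + (f x + ∑ (remove x xs) f) ≡⟨ +-swapˡ (f y) (f x) _ ⟩
  f x + (f y + ∑ (remove x xs) f) ∎
  where open ≡-Reasoning

∑-restrict : ∀ A R F → Distinct A → Distinct R → R ⊆ᵇ A → ∑[ x ∈ A ] (⟦ x ∈ᵇ R ⟧ * F x) ≡ ∑ R F
∑-restrict [] [] F _ _ _ = refl
∑-restrict [] (r ∷ R) F _ _ R⊆[] with () ← R⊆[] r (∈ᵇ-here r R)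
∑-restrict (a ∷ A) R F (a∉A , A-distinct) R-distinct R⊆a∷A with a ∈ᵇ R in a∈R
... | true = begin
  F a + 0 + ∑[ x ∈ A ] (⟦ x ∈ᵇ R ⟧ * F x)          ≡⟨ cong₂ _+_ (+-identityʳ (F a)) (∑-cong-∈ᵇ A (λ x x∈A →
                                                         cong (λ b → ⟦ b ⟧ * F x) (sym (∈ᵇ-remove-≢ R (≢a x x∈A))))) ⟩
  F a + ∑[ x ∈ A ] (⟦ x ∈ᵇ remove a R ⟧ * F x)    ≡⟨ cong (F a +_) (∑-restrict A (remove a R) F A-distinct (Distinct-remove a R R-distinct) R∖a⊆A) ⟩
  F a + ∑ (remove a R) F                          ≡⟨ ∑-remove a R F a∈R ⟨
  ∑ R F                                           ∎
  where
  open ≡-Reasoning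
  ≢a : ∀ x → x ∈ᵇ A ≡ true → x ≢ a
  ≢a x x∈A refl with () ← trans (sym x∈A) a∉A
  R∖a⊆A : remove a R ⊆ᵇ A
  R∖a⊆A y y∈ = ∈ᵇ-∷⁻ y a A (R⊆a∷A y (∈ᵇ-remove⁻ y a R y∈))
                 (λ { refl → contradiction (trans (sym y∈) (∉ᵇ-remove a R R-distinct)) λ () })
... | false = ∑-restrict A R F A-distinct R-distinct R⊆A
  where
  R⊆A : R ⊆ᵇ A
  R⊆A y y∈R = ∈ᵇ-∷⁻ y a A (R⊆a∷A y y∈R) (λ { refl → contradiction (trans (sym y∈R) a∈R) λ () })

∑< : ℕ → (ℕ → ℕ) → ℕ
∑< zero f = 0
∑< (suc k) f = f 0 + ∑< k (λ i → f (suc i))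

syntax ∑< k (λ i → e) = ∑[ i < k ] e

∑<-cong : ∀ k {f g : ℕ → ℕ} → (∀ i → i < k → f i ≡ g i) → ∑< k f ≡ ∑< k g
∑<-cong zero _ = refl
∑<-cong (suc k) f≗g = cong₂ _+_ (f≗g 0 z<s) (∑<-cong k (λ i i<k → f≗g (suc i) (s<s i<k)))

∑<-zero : ∀ k → ∑[ i < k ] 0 ≡ 0
∑<-zero zero = refl
∑<-zero (suc k) = ∑<-zero k

∑<-distrib-+ : ∀ k f g → ∑[ i < k ] (f i + g i) ≡ ∑< k f + ∑< k g
∑<-distrib-+ zero f g = refl
∑<-distrib-+ (suc k) f g = trans (cong (f 0 + g 0 +_) (∑<-distrib-+ k (λ i → f (suc i)) (λ i → g (suc i))))
                                 (+-interchange (f 0) (g 0) _ _)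

∑<-*ˡ : ∀ k c f → ∑[ i < k ] (c * f i) ≡ c * ∑< k f
∑<-*ˡ zero c f = sym (*-zeroʳ c)
∑<-*ˡ (suc k) c f = trans (cong (c * f 0 +_) (∑<-*ˡ k c (λ i → f (suc i)))) (sym (*-distribˡ-+ c (f 0) _))

∑<-*ʳ : ∀ k c f → ∑[ i < k ] (f i * c) ≡ ∑< k f * c
∑<-*ʳ k c f = trans (∑<-cong k (λ i _ → *-comm (f i) c)) (trans (∑<-*ˡ k c f) (*-comm c (∑< k f)))

∑<-last : ∀ k f → ∑< (suc k) f ≡ ∑< k f + f k
∑<-last zero f = +-comm (f 0) 0
∑<-last (suc k) f = trans (cong (f 0 +_) (∑<-last k (λ i → f (suc i)))) (sym (+-assoc (f 0) _ _))

∑-∑<-comm : ∀ {A : Set} (xs : List A) k (f : ℕ → A → ℕ) → ∑[ x ∈ xs ] ∑[ i < k ] f i x ≡ ∑[ i < k ] ∑ xs (f i)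
∑-∑<-comm xs zero f = ∑-zero xs
∑-∑<-comm xs (suc k) f = trans (∑-distrib-+ xs (f 0) (λ x → ∑[ i < k ] f (suc i) x))
                               (cong (∑ xs (f 0) +_) (∑-∑<-comm xs k (λ i → f (suc i))))

nCk*k!*[n∸k]!≡n! : ∀ {n k} → k ≤ n → (n C k) * (k ! * (n ∸ k) !) ≡ n !
nCk*k!*[n∸k]!≡n! {n} {k} k≤n = trans (cong (_* (k ! * (n ∸ k) !)) (nCk≡n!/k![n-k]! k≤n)) (m/n*n≡m {{k !* (n ∸ k) !≢0}} (k![n∸k]!∣n! k≤n))

C-subset-of-subset : ∀ {N L i} → i ≤ L → L ≤ N →
  (N C i) * ((N ∸ i) C (L ∸ i)) * (L ! * (N ∸ L) !) ≡ N ! * (L C i)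
C-subset-of-subset {N} {L} {i} i≤L L≤N = begin
  A * B * (L ! * (N ∸ L) !)                     ≡⟨ cong (λ z → A * B * (z * (N ∸ L) !)) (sym choose-i) ⟩
  A * B * (Y * (i ! * j !) * (N ∸ L) !)         ≡⟨ rearrange A B Y (i !) (j !) ((N ∸ L) !) ⟩
  Y * (A * (i ! * (B * (j ! * (N ∸ L) !))))    ≡⟨ cong (λ z → Y * (A * (i ! * z))) choose-j ⟩
  Y * (A * (i ! * (N ∸ i) !))                   ≡⟨ cong (Y *_) (nCk*k!*[n∸k]!≡n! (≤-trans i≤L L≤N)) ⟩
  Y * N !                                       ≡⟨ *-comm Y (N !) ⟩
  N ! * Y                                       ∎
  where
  open ≡-Reasoning
  j = L ∸ i
  A = N C i
  B = (N ∸ i) C j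
  Y = L C i
  rearrange : ∀ a b y p q r → a * b * (y * (p * q) * r) ≡ y * (a * (p * (b * (q * r))))
  rearrange = solve-∀
  choose-i : Y * (i ! * j !) ≡ L !
  choose-i = nCk*k!*[n∸k]!≡n! i≤L
  choose-j : B * (j ! * (N ∸ L) !) ≡ (N ∸ i) !
  choose-j = subst (λ r → B * (j ! * r !) ≡ (N ∸ i) !)
                   (trans (∸-+-assoc N i j) (cong (N ∸_) (m+[n∸m]≡n i≤L)))
                   (nCk*k!*[n∸k]!≡n! (∸-monoˡ-≤ i L≤N))

∑nCk≡2^n : ∀ n → ∑[ i < suc n ] (n C i) ≡ 2 ^ n
∑nCk≡2^n zero = refl
∑nCk≡2^n (suc n) = begin
  1 + ∑[ i < suc n ] (suc n C suc i)               ≡⟨ cong suc (∑<-cong (suc n) (λ i _ → sym (nCk+nC[k+1]≡[n+1]C[k+1] n i))) ⟩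
  1 + ∑[ i < suc n ] (n C i + n C suc i)          ≡⟨ cong suc (∑<-distrib-+ (suc n) (n C_) (λ i → n C suc i)) ⟩
  1 + (row + ∑[ i < suc n ] (n C suc i))          ≡⟨ cong (λ s → suc (s + ∑[ i < suc n ] (n C suc i))) (∑nCk≡2^n n) ⟩
  1 + (2 ^ n + ∑[ i < suc n ] (n C suc i))        ≡⟨ sym (+-suc (2 ^ n) _) ⟩
  2 ^ n + ∑[ i < suc (suc n) ] (n C i)            ≡⟨ cong (2 ^ n +_) (∑<-last (suc n) (n C_)) ⟩
  2 ^ n + (row + n C suc n)                        ≡⟨ cong₂ (λ s t → 2 ^ n + (s + t)) (∑nCk≡2^n n) (k>n⇒nCk≡0 (n<1+n n)) ⟩
  2 ^ n + (2 ^ n + 0)                              ∎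
  where
  open ≡-Reasoning
  row = ∑[ i < suc n ] (n C i)

-- ∑Arr R m f sums f R′ w over the words w of m distinct letters taken from R,
-- where R′ lists the letters of R that w leaves unused.
∑Arr : List ℕ → ℕ → (List ℕ → List ℕ → ℕ) → ℕ
∑Arr R zero f = f R []
∑Arr R (suc m) f = ∑[ x ∈ R ] ∑Arr (remove x R) m (λ R′ w → f R′ (x ∷ w))

record Arrangement (R : List ℕ) (m : ℕ) (R′ w : List ℕ) : Set where
  field
    distinct-rest : Distinct R′
    distinct-word : Distinct w
    word⊆ : ∀ x → x ∈ᵇ w ≡ true → x ∈ᵇ R ≡ true
    length-word : length w ≡ m
    length-rest : length R′ + m ≡ length R

open Arrangement

length-rest-∸ : ∀ {R m R′ w} → Arrangement R m R′ w → length R′ ≡ length R ∸ m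
length-rest-∸ {R} {m} {R′} arr = trans (sym (m+n∸n≡m (length R′) m)) (cong (_∸ m) (length-rest arr))

arrangement-[] : ∀ R → Distinct R → Arrangement R 0 R []
arrangement-[] R R-distinct = record
  { distinct-rest = R-distinct
  ; distinct-word = tt
  ; word⊆ = λ _ ()
  ; length-word = refl
  ; length-rest = +-identityʳ (length R)
  }

arrangement-∷ : ∀ {R m R′ w} x → Distinct R → x ∈ᵇ R ≡ true →
                Arrangement (remove x R) m R′ w → Arrangement R (suc m) R′ (x ∷ w)
arrangement-∷ {R} {m} {R′} {w} x R-distinct x∈R arr = record
  { distinct-rest = distinct-rest arr
  ; distinct-word = x∉w , distinct-word arr
  ; word⊆ = word⊆′
  ; length-word = cong suc (length-word arr)
  ; length-rest = trans (+-suc (length R′) m) (trans (cong suc (length-rest arr)) (length-remove x R x∈R))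
  }
  where
  x∉w : x ∈ᵇ w ≡ false
  x∉w with x ∈ᵇ w in x∈w
  ... | false = refl
  ... | true with () ← trans (sym (word⊆ arr x x∈w)) (∉ᵇ-remove x R R-distinct)
  word⊆′ : ∀ y → y ∈ᵇ (x ∷ w) ≡ true → y ∈ᵇ R ≡ true
  word⊆′ y y∈ with y ≡ᵇ x | ≡ᵇ-reflects-≡ y x
  ... | true | ofʸ refl = x∈R
  ... | false | _ = ∈ᵇ-remove⁻ y x R (word⊆ arr y y∈)

∑Arr-cong : ∀ R m {f g : List ℕ → List ℕ → ℕ} → Distinct R →
            (∀ R′ w → Arrangement R m R′ w → f R′ w ≡ g R′ w) → ∑Arr R m f ≡ ∑Arr R m g
∑Arr-cong R zero R-distinct f≗g = f≗g R [] (arrangement-[] R R-distinct)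
∑Arr-cong R (suc m) R-distinct f≗g = ∑-cong-∈ᵇ R λ x x∈R →
  ∑Arr-cong (remove x R) m (Distinct-remove x R R-distinct)
    (λ R′ w arr → f≗g R′ (x ∷ w) (arrangement-∷ x R-distinct x∈R arr))

∑Arr-cong′ : ∀ R m {f g : List ℕ → List ℕ → ℕ} → (∀ R′ w → f R′ w ≡ g R′ w) → ∑Arr R m f ≡ ∑Arr R m g
∑Arr-cong′ R zero f≗g = f≗g R []
∑Arr-cong′ R (suc m) f≗g = ∑-cong R (λ x → ∑Arr-cong′ (remove x R) m (λ R′ w → f≗g R′ (x ∷ w)))

∑Arr-zero : ∀ R m → ∑Arr R m (λ _ _ → 0) ≡ 0
∑Arr-zero R zero = refl
∑Arr-zero R (suc m) = trans (∑-cong R (λ x → ∑Arr-zero (remove x R) m)) (∑-zero R)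

∑Arr-*ˡ : ∀ R m c f → ∑Arr R m (λ R′ w → c * f R′ w) ≡ c * ∑Arr R m f
∑Arr-*ˡ R zero c f = refl
∑Arr-*ˡ R (suc m) c f = trans (∑-cong R (λ x → ∑Arr-*ˡ (remove x R) m c _)) (∑-*ˡ R c _)

∑Arr-*ʳ : ∀ R m c f → ∑Arr R m (λ R′ w → f R′ w * c) ≡ ∑Arr R m f * c
∑Arr-*ʳ R m c f = trans (∑Arr-cong′ R m (λ R′ w → *-comm (f R′ w) c)) (trans (∑Arr-*ˡ R m c f) (*-comm c _))

∑Arr-∑<-comm : ∀ R m k (f : ℕ → List ℕ → List ℕ → ℕ) →
               ∑Arr R m (λ R′ w → ∑[ i < k ] f i R′ w) ≡ ∑[ i < k ] ∑Arr R m (f i)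
∑Arr-∑<-comm R zero k f = refl
∑Arr-∑<-comm R (suc m) k f = trans (∑-cong R (λ x → ∑Arr-∑<-comm (remove x R) m k _))
  (∑-∑<-comm R k (λ i x → ∑Arr (remove x R) m (λ R′ w → f i R′ (x ∷ w))))

∑Arr-++ : ∀ R i j f → ∑Arr R (i + j) f ≡ ∑Arr R i (λ R′ u → ∑Arr R′ j (λ R″ v → f R″ (u ++ v)))
∑Arr-++ R zero j f = refl
∑Arr-++ R (suc i) j f = ∑-cong R (λ x → ∑Arr-++ (remove x R) i j _)

∑Arr-remove-unused : ∀ y R m (f : List ℕ → ℕ) → (∀ w → y ∈ᵇ w ≡ true → f w ≡ 0) →
                     ∑Arr R m (λ _ w → f w) ≡ ∑Arr (remove y R) m (λ _ w → f w)
∑Arr-remove-unused y R zero f _ = refl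
∑Arr-remove-unused y R (suc m) f f-vanishes with y ∈ᵇ R in y∈R?
... | false = cong (λ S → ∑Arr S (suc m) (λ _ w → f w)) (sym (remove-∉ᵇ y R y∈R?))
... | true = trans (∑-remove y R _ y∈R?) (cong₂ _+_ starts-with-y (∑-cong (remove y R) other-start))
  where
  starts-with-y : ∑Arr (remove y R) m (λ _ w → f (y ∷ w)) ≡ 0
  starts-with-y = trans (∑Arr-cong′ (remove y R) m (λ _ w → f-vanishes (y ∷ w) (∈ᵇ-here y w)))
                        (∑Arr-zero (remove y R) m)
  other-start : ∀ x → ∑Arr (remove x R) m (λ _ w → f (x ∷ w)) ≡ ∑Arr (remove x (remove y R)) m (λ _ w → f (x ∷ w))
  other-start x = trans (∑Arr-remove-unused y (remove x R) m (λ w → f (x ∷ w))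
                          (λ w y∈w → f-vanishes (x ∷ w) (∈ᵇ-there y x w y∈w)))
                        (cong (λ S → ∑Arr S m (λ _ w → f (x ∷ w))) (remove-comm y x R))

chainᵇ : {_≺_ : ℕ → ℕ → Set} → Decidable _≺_ → List ℕ → Bool
chainᵇ _≺?_ (x ∷ y ∷ w) = does (x ≺? y) ∧ chainᵇ _≺?_ (y ∷ w)
chainᵇ _ _ = true

module _ {_≺_ : ℕ → ℕ → Set} (_≺?_ : Decidable _≺_) (≺-sto : IsStrictTotalOrder _≡_ _≺_) where
  open IsStrictTotalOrder ≺-sto using (compare; asym) renaming (trans to ≺-trans)

  IsLeast : ℕ → List ℕ → Set
  IsLeast m xs = m ∈ᵇ xs ≡ true × (∀ x → x ∈ᵇ xs ≡ true → x ≢ m → m ≺ x)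

  least : ∀ x xs → ∃ λ m → IsLeast m (x ∷ xs)
  least x [] = x , ∈ᵇ-here x [] , λ y y∈ y≢x → contradiction (∈ᵇ-∷⁻ y x [] y∈ y≢x) λ ()
  least x (y ∷ xs) with least y xs
  ... | m , m∈ , m-least with compare x m
  ...   | tri< x≺m _ _ = x , ∈ᵇ-here x (y ∷ xs) , λ z z∈ z≢x → x≺ z (∈ᵇ-∷⁻ z x (y ∷ xs) z∈ z≢x)
    where
    x≺ : ∀ z → z ∈ᵇ (y ∷ xs) ≡ true → x ≺ z
    x≺ z z∈ with z ≟ m
    ... | yes refl = x≺m
    ... | no z≢m = ≺-trans x≺m (m-least z z∈ z≢m)
  ...   | tri≈ _ refl _ = x , ∈ᵇ-here x (y ∷ xs) , λ z z∈ z≢x → m-least z (∈ᵇ-∷⁻ z x (y ∷ xs) z∈ z≢x) z≢x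
  ...   | tri> _ _ m≺x = m , ∈ᵇ-there m x (y ∷ xs) m∈ , m≺
    where
    m≺ : ∀ z → z ∈ᵇ (x ∷ y ∷ xs) ≡ true → z ≢ m → m ≺ z
    m≺ z z∈ z≢m with z ≟ x
    ... | yes refl = m≺x
    ... | no z≢x = m-least z (∈ᵇ-∷⁻ z x (y ∷ xs) z∈ z≢x) z≢m

  chain-head : ∀ x y w → chainᵇ _≺?_ (x ∷ w) ≡ true → y ∈ᵇ w ≡ true → x ≺ y
  chain-head x y (z ∷ w) chain y∈ with x ≺? z
  ... | no _ with () ← chain
  ... | yes x≺z with y ≡ᵇ z | ≡ᵇ-reflects-≡ y z
  ...   | true | ofʸ refl = x≺z
  ...   | false | _ = ≺-trans x≺z (chain-head z y w chain y∈)

  chain-least : ∀ m w → (∀ y → y ∈ᵇ w ≡ true → m ≺ y) → chainᵇ _≺?_ (m ∷ w) ≡ chainᵇ _≺?_ w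
  chain-least m [] _ = refl
  chain-least m (z ∷ w) m-least with m ≺? z
  ... | yes _ = refl
  ... | no m⊀z = contradiction (m-least z (∈ᵇ-here z w)) m⊀z

  -- The least letter m of R either starts a chain or does not occur in it: Pascal's rule.
  count-chains : ∀ N R b → Distinct R → length R ≡ N → ∑Arr R b (λ _ w → ⟦ chainᵇ _≺?_ w ⟧) ≡ N C b
  count-chains N R zero _ _ = refl
  count-chains zero [] (suc b) _ _ = refl
  count-chains (suc N) (r ∷ R) (suc b) R-distinct R-length with least r R
  ... | m , m∈ , m-least = begin
    ∑[ x ∈ r ∷ R ] ∑Arr (remove x (r ∷ R)) b (λ _ w → Chain (x ∷ w))
      ≡⟨ ∑-remove m (r ∷ R) _ m∈ ⟩
    ∑Arr R′ b (λ _ w → Chain (m ∷ w)) + ∑[ x ∈ R′ ] ∑Arr (remove x (r ∷ R)) b (λ _ w → Chain (x ∷ w))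
      ≡⟨ cong₂ _+_ (∑Arr-cong R′ b R′-distinct m-first) (∑-cong-∈ᵇ R′ m-unused) ⟩
    ∑Arr R′ b (λ _ w → Chain w) + ∑Arr R′ (suc b) (λ _ w → Chain w)
      ≡⟨ cong₂ _+_ (count-chains N R′ b R′-distinct length-R′) (count-chains N R′ (suc b) R′-distinct length-R′) ⟩
    N C b + N C suc b
      ≡⟨ nCk+nC[k+1]≡[n+1]C[k+1] N b ⟩
    suc N C suc b ∎
    where
    open ≡-Reasoning
    Chain : List ℕ → ℕ
    Chain w = ⟦ chainᵇ _≺?_ w ⟧
    R′ = remove m (r ∷ R)
    R′-distinct : Distinct R′
    R′-distinct = Distinct-remove m (r ∷ R) R-distinct
    length-R′ : length R′ ≡ N
    length-R′ = suc-injective (trans (length-remove m (r ∷ R) m∈) R-length)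
    ≢m : ∀ y → y ∈ᵇ R′ ≡ true → y ≢ m
    ≢m y y∈ refl with () ← trans (sym y∈) (∉ᵇ-remove m (r ∷ R) R-distinct)
    m-first : ∀ R″ w → Arrangement R′ b R″ w → Chain (m ∷ w) ≡ Chain w
    m-first R″ w arr = cong ⟦_⟧ (chain-least m w (λ y y∈w →
      let y∈R′ = word⊆ arr y y∈w in m-least y (∈ᵇ-remove⁻ y m (r ∷ R) y∈R′) (≢m y y∈R′)))
    m-unused : ∀ x → x ∈ᵇ R′ ≡ true →
      ∑Arr (remove x (r ∷ R)) b (λ _ w → Chain (x ∷ w)) ≡ ∑Arr (remove x R′) b (λ _ w → Chain (x ∷ w))
    m-unused x x∈R′ = trans (∑Arr-remove-unused m (remove x (r ∷ R)) b (λ w → Chain (x ∷ w)) m∉)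
                            (cong (λ S → ∑Arr S b (λ _ w → Chain (x ∷ w))) (remove-comm m x (r ∷ R)))
      where
      m≺x : m ≺ x
      m≺x = m-least x (∈ᵇ-remove⁻ x m (r ∷ R) x∈R′) (≢m x x∈R′)
      m∉ : ∀ w → m ∈ᵇ w ≡ true → Chain (x ∷ w) ≡ 0
      m∉ w m∈w with chainᵇ _≺?_ (x ∷ w) in chain
      ... | false = refl
      ... | true = contradiction (chain-head x m w chain m∈w) (asym m≺x)

increasingᵇ : List ℕ → Bool
increasingᵇ = chainᵇ _<?_

decreasingᵇ≡chainᵇ : ∀ w → decreasingᵇ w ≡ chainᵇ (flip _<?_) w
decreasingᵇ≡chainᵇ [] = refl
decreasingᵇ≡chainᵇ (x ∷ []) = refl
decreasingᵇ≡chainᵇ (x ∷ y ∷ w) = cong ((y <ᵇ x) ∧_) (decreasingᵇ≡chainᵇ (y ∷ w))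

count-increasing : ∀ N R b → Distinct R → length R ≡ N → ∑Arr R b (λ _ w → ⟦ increasingᵇ w ⟧) ≡ N C b
count-increasing = count-chains _<?_ <-isStrictTotalOrder

count-decreasing : ∀ N R b → Distinct R → length R ≡ N → ∑Arr R b (λ _ w → ⟦ decreasingᵇ w ⟧) ≡ N C b
count-decreasing N R b R-distinct R-length =
  trans (∑Arr-cong′ R b (λ _ w → cong ⟦_⟧ (decreasingᵇ≡chainᵇ w)))
        (count-chains (flip _<?_) (flip-isStrictTotalOrder <-isStrictTotalOrder) N R b R-distinct R-length)

splitsAtᵇ : ℕ → List ℕ → Bool
splitsAtᵇ i u = increasingᵇ (take i u) ∧ decreasingᵇ (drop i u)

splitsᵇ : List ℕ → ℕ
splitsᵇ u = ∑[ i < suc (length u) ] ⟦ splitsAtᵇ i u ⟧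

peak-splits : ∀ a w → Distinct (a ∷ w) →
  ⟦ decreasingᵇ (a ∷ w) ⟧ + ∑[ i < suc (length w) ] ⟦ increasingᵇ (a ∷ take i w) ∧ decreasingᵇ (drop i w) ⟧
    ≡ 2 * ⟦ unimodalᵇ (a ∷ w) ⟧
peak-splits a [] _ = refl
peak-splits a (y ∷ w) (a∉ , distinct) with a <ᵇ y | <ᵇ-reflects-< a y
... | true | ofʸ a<y rewrite ≮⇒<ᵇ≡false (<⇒≯ a<y) = peak-splits y w distinct
... | false | ofⁿ a≮y rewrite <⇒<ᵇ≡true (≤∧≢⇒< (≮⇒≥ a≮y) (≢-sym (proj₁ (∉ᵇ-∷⁻ {xs = w} a∉)))) =
  cong (λ s → ⟦ decreasingᵇ (y ∷ w) ⟧ + (⟦ decreasingᵇ (y ∷ w) ⟧ + s)) (∑<-zero (suc (length w)))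

unimodal-splits : ∀ u → Distinct u → u ≢ [] → splitsᵇ u ≡ 2 * ⟦ unimodalᵇ u ⟧
unimodal-splits [] _ []≢[] = contradiction refl []≢[]
unimodal-splits (a ∷ w) distinct _ = peak-splits a w distinct

count-splitsAt : ∀ N R L i → Distinct R → length R ≡ N → i ≤ L →
  ∑Arr R L (λ _ u → ⟦ splitsAtᵇ i u ⟧) ≡ (N C i) * ((N ∸ i) C (L ∸ i))
count-splitsAt N R L i R-distinct R-length i≤L = begin
  ∑Arr R L (λ _ u → ⟦ splitsAtᵇ i u ⟧)
    ≡⟨ cong (λ m → ∑Arr R m (λ _ u → ⟦ splitsAtᵇ i u ⟧)) (m+[n∸m]≡n i≤L) ⟨
  ∑Arr R (i + j) (λ _ u → ⟦ splitsAtᵇ i u ⟧)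
    ≡⟨ ∑Arr-++ R i j _ ⟩
  ∑Arr R i (λ R′ u → ∑Arr R′ j (λ _ v → ⟦ splitsAtᵇ i (u ++ v) ⟧))
    ≡⟨ ∑Arr-cong R i R-distinct split-after-prefix ⟩
  ∑Arr R i (λ _ u → ⟦ increasingᵇ u ⟧ * ((N ∸ i) C j))
    ≡⟨ ∑Arr-*ʳ R i _ _ ⟩
  ∑Arr R i (λ _ u → ⟦ increasingᵇ u ⟧) * ((N ∸ i) C j)
    ≡⟨ cong (_* ((N ∸ i) C j)) (count-increasing N R i R-distinct R-length) ⟩
  (N C i) * ((N ∸ i) C j) ∎
  where
  open ≡-Reasoning
  j = L ∸ i
  split-after-prefix : ∀ R′ u → Arrangement R i R′ u →
    ∑Arr R′ j (λ _ v → ⟦ splitsAtᵇ i (u ++ v) ⟧) ≡ ⟦ increasingᵇ u ⟧ * ((N ∸ i) C j)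
  split-after-prefix R′ u arr = begin
    ∑Arr R′ j (λ _ v → ⟦ splitsAtᵇ i (u ++ v) ⟧)
      ≡⟨ ∑Arr-cong′ R′ j (λ _ v → cong₂ (λ p s → ⟦ increasingᵇ p ∧ decreasingᵇ s ⟧)
                                         (take-++-length u v (length-word arr)) (drop-++-length u v (length-word arr))) ⟩
    ∑Arr R′ j (λ _ v → ⟦ increasingᵇ u ∧ decreasingᵇ v ⟧)
      ≡⟨ ∑Arr-cong′ R′ j (λ _ v → ⟦∧⟧ (increasingᵇ u) (decreasingᵇ v)) ⟩
    ∑Arr R′ j (λ _ v → ⟦ increasingᵇ u ⟧ * ⟦ decreasingᵇ v ⟧)
      ≡⟨ ∑Arr-*ˡ R′ j ⟦ increasingᵇ u ⟧ (λ _ v → ⟦ decreasingᵇ v ⟧) ⟩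
    ⟦ increasingᵇ u ⟧ * ∑Arr R′ j (λ _ v → ⟦ decreasingᵇ v ⟧)
      ≡⟨ cong (⟦ increasingᵇ u ⟧ *_) (count-decreasing (N ∸ i) R′ j (distinct-rest arr)
                                        (trans (length-rest-∸ arr) (cong (_∸ i) R-length))) ⟩
    ⟦ increasingᵇ u ⟧ * ((N ∸ i) C j) ∎

count-unimodal : ∀ N R l → Distinct R → length R ≡ N → suc l ≤ N →
  ∑Arr R (suc l) (λ _ u → ⟦ unimodalᵇ u ⟧) * (suc l ! * (N ∸ suc l) !) ≡ N ! * 2 ^ l
count-unimodal N R l R-distinct R-length L≤N = *-cancelˡ-≡ _ _ 2 (begin
  2 * (U * K)                                              ≡⟨ *-assoc 2 U K ⟨
  2 * U * K                                                ≡⟨ cong (_* K) twice-U ⟩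
  ∑[ i < suc L ] ((N C i) * ((N ∸ i) C (L ∸ i))) * K       ≡⟨ ∑<-*ʳ (suc L) K (λ i → (N C i) * ((N ∸ i) C (L ∸ i))) ⟨
  ∑[ i < suc L ] ((N C i) * ((N ∸ i) C (L ∸ i)) * K)       ≡⟨ ∑<-cong (suc L) (λ i i<1+L → C-subset-of-subset (m<1+n⇒m≤n i<1+L) L≤N) ⟩
  ∑[ i < suc L ] (N ! * (L C i))                           ≡⟨ ∑<-*ˡ (suc L) (N !) (L C_) ⟩
  N ! * ∑[ i < suc L ] (L C i)                             ≡⟨ cong (N ! *_) (∑nCk≡2^n L) ⟩
  N ! * (2 * 2 ^ l)                                        ≡⟨ *-swapˡ (N !) 2 (2 ^ l) ⟩
  2 * (N ! * 2 ^ l)                                        ∎)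
  where
  open ≡-Reasoning
  L = suc l
  U = ∑Arr R L (λ _ u → ⟦ unimodalᵇ u ⟧)
  K = L ! * (N ∸ L) !
  two-splits : ∀ R′ u → Arrangement R L R′ u → 2 * ⟦ unimodalᵇ u ⟧ ≡ ∑[ i < suc L ] ⟦ splitsAtᵇ i u ⟧
  two-splits R′ [] arr with () ← length-word arr
  two-splits R′ u@(_ ∷ _) arr = begin
    2 * ⟦ unimodalᵇ u ⟧ ≡⟨ unimodal-splits u (distinct-word arr) (λ ()) ⟨
    splitsᵇ u           ≡⟨ cong (λ m → ∑[ i < suc m ] ⟦ splitsAtᵇ i u ⟧) (length-word arr) ⟩
    ∑[ i < suc L ] ⟦ splitsAtᵇ i u ⟧ ∎
  twice-U : 2 * U ≡ ∑[ i < suc L ] ((N C i) * ((N ∸ i) C (L ∸ i)))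
  twice-U = begin
    2 * U                                                ≡⟨ ∑Arr-*ˡ R L 2 (λ _ u → ⟦ unimodalᵇ u ⟧) ⟨
    ∑Arr R L (λ _ u → 2 * ⟦ unimodalᵇ u ⟧)               ≡⟨ ∑Arr-cong R L R-distinct two-splits ⟩
    ∑Arr R L (λ _ u → ∑[ i < suc L ] ⟦ splitsAtᵇ i u ⟧)  ≡⟨ ∑Arr-∑<-comm R L (suc L) (λ i _ u → ⟦ splitsAtᵇ i u ⟧) ⟩
    ∑[ i < suc L ] ∑Arr R L (λ _ u → ⟦ splitsAtᵇ i u ⟧)  ≡⟨ ∑<-cong (suc L) (λ i i<1+L → count-splitsAt N R L i R-distinct R-length (m<1+n⇒m≤n i<1+L)) ⟩
    ∑[ i < suc L ] ((N C i) * ((N ∸ i) C (L ∸ i)))       ∎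

∑Arr-λ-unimodal-∷ : ∀ R L lam → Distinct R →
  ∑Arr R (L + sum lam) (λ _ w → ⟦ λ-unimodalᵇ (L ∷ lam) w ⟧)
    ≡ ∑Arr R L (λ R′ u → ⟦ unimodalᵇ u ⟧ * ∑Arr R′ (sum lam) (λ _ v → ⟦ λ-unimodalᵇ lam v ⟧))
∑Arr-λ-unimodal-∷ R L lam R-distinct =
  trans (∑Arr-++ R L (sum lam) _) (∑Arr-cong R L R-distinct first-block)
  where
  first-block : ∀ R′ u → Arrangement R L R′ u →
    ∑Arr R′ (sum lam) (λ _ v → ⟦ λ-unimodalᵇ (L ∷ lam) (u ++ v) ⟧)
      ≡ ⟦ unimodalᵇ u ⟧ * ∑Arr R′ (sum lam) (λ _ v → ⟦ λ-unimodalᵇ lam v ⟧)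
  first-block R′ u arr =
    trans (∑Arr-cong′ R′ (sum lam) (λ _ v →
             trans (cong₂ (λ p s → ⟦ unimodalᵇ p ∧ λ-unimodalᵇ lam s ⟧)
                          (take-++-length u v (length-word arr)) (drop-++-length u v (length-word arr)))
                   (⟦∧⟧ (unimodalᵇ u) (λ-unimodalᵇ lam v))))
          (∑Arr-*ˡ R′ (sum lam) ⟦ unimodalᵇ u ⟧ (λ _ v → ⟦ λ-unimodalᵇ lam v ⟧))

length≤sum : ∀ lam → All (0 <_) lam → length lam ≤ sum lam
length≤sum [] [] = z≤n
length≤sum (_ ∷ lam) (l>0 ∷ lam-pos) = +-mono-≤ l>0 (length≤sum lam lam-pos)

count-λ-unimodal : ∀ lam → All (0 <_) lam → ∀ R → Distinct R → length R ≡ sum lam →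
  ∑Arr R (sum lam) (λ _ w → ⟦ λ-unimodalᵇ lam w ⟧) * product (map _! lam) ≡ sum lam ! * 2 ^ (sum lam ∸ length lam)
count-λ-unimodal [] [] R _ _ = refl
count-λ-unimodal (suc l ∷ lam) (_ ∷ lam-pos) R R-distinct R-length = begin
  H * (L ! * P)                    ≡⟨ cong (_* (L ! * P)) (∑Arr-λ-unimodal-∷ R L lam R-distinct) ⟩
  W * (L ! * P)                    ≡⟨ *-swapˡ W (L !) P ⟩
  L ! * (W * P)                    ≡⟨ cong (L ! *_) W*P ⟩
  L ! * (U * (s ! * E))            ≡⟨ rearrange (L !) U (s !) E ⟩
  U * (L ! * s !) * E              ≡⟨ cong (λ r → U * (L ! * r !) * E) (m+n∸m≡n L s) ⟨
  U * (L ! * (N ∸ L) !) * E        ≡⟨ cong (_* E) (count-unimodal N R l R-distinct R-length (m≤m+n L s)) ⟩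
  N ! * 2 ^ l * E                  ≡⟨ *-assoc (N !) (2 ^ l) E ⟩
  N ! * (2 ^ l * 2 ^ (s ∸ k))      ≡⟨ cong (N ! *_) (^-distribˡ-+-* 2 l (s ∸ k)) ⟨
  N ! * 2 ^ (l + (s ∸ k))          ≡⟨ cong (λ e → N ! * 2 ^ e) (+-∸-assoc l (length≤sum lam lam-pos)) ⟨
  N ! * 2 ^ (l + s ∸ k)            ∎
  where
  open ≡-Reasoning
  L = suc l
  s = sum lam
  k = length lam
  N = L + s
  P = product (map _! lam)
  E = 2 ^ (s ∸ k)
  H = ∑Arr R N (λ _ w → ⟦ λ-unimodalᵇ (L ∷ lam) w ⟧)
  U = ∑Arr R L (λ _ u → ⟦ unimodalᵇ u ⟧)
  Count : List ℕ → ℕ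
  Count R′ = ∑Arr R′ s (λ _ v → ⟦ λ-unimodalᵇ lam v ⟧)
  W = ∑Arr R L (λ R′ u → ⟦ unimodalᵇ u ⟧ * Count R′)
  rearrange : ∀ a b c d → a * (b * (c * d)) ≡ b * (a * c) * d
  rearrange = solve-∀
  W*P : W * P ≡ U * (s ! * E)
  W*P = begin
    W * P
      ≡⟨ ∑Arr-*ʳ R L P (λ R′ u → ⟦ unimodalᵇ u ⟧ * Count R′) ⟨
    ∑Arr R L (λ R′ u → ⟦ unimodalᵇ u ⟧ * Count R′ * P)
      ≡⟨ ∑Arr-cong R L R-distinct (λ R′ u arr → trans (*-assoc ⟦ unimodalᵇ u ⟧ (Count R′) P)
           (cong (⟦ unimodalᵇ u ⟧ *_) (count-λ-unimodal lam lam-pos R′ (distinct-rest arr)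
             (trans (length-rest-∸ arr) (trans (cong (_∸ L) R-length) (m+n∸m≡n L s)))))) ⟩
    ∑Arr R L (λ _ u → ⟦ unimodalᵇ u ⟧ * (s ! * E))
      ≡⟨ ∑Arr-*ʳ R L (s ! * E) (λ _ u → ⟦ unimodalᵇ u ⟧) ⟩
    U * (s ! * E) ∎

∑-words-suc : ∀ A m f → ∑ (words A (suc m)) f ≡ ∑[ x ∈ A ] ∑[ w ∈ words A m ] f (x ∷ w)
∑-words-suc A m f = begin
  ∑ (concatMap (λ w → map (_∷ w) A) (words A m)) f  ≡⟨ ∑-concatMap (λ w → map (_∷ w) A) (words A m) f ⟩
  ∑[ w ∈ words A m ] ∑ (map (_∷ w) A) f             ≡⟨ ∑-cong (words A m) (λ w → ∑-map (_∷ w) A f) ⟩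
  ∑[ w ∈ words A m ] ∑[ x ∈ A ] f (x ∷ w)           ≡⟨ ∑-comm (words A m) A (λ w x → f (x ∷ w)) ⟩
  ∑[ x ∈ A ] ∑[ w ∈ words A m ] f (x ∷ w)           ∎
  where open ≡-Reasoning

∑-words-cong : ∀ A m {f g : List ℕ → ℕ} → (∀ w → length w ≡ m → f w ≡ g w) → ∑ (words A m) f ≡ ∑ (words A m) g
∑-words-cong A zero f≗g = cong (_+ 0) (f≗g [] refl)
∑-words-cong A (suc m) {f} {g} f≗g = begin
  ∑ (words A (suc m)) f                    ≡⟨ ∑-words-suc A m f ⟩
  ∑[ x ∈ A ] ∑[ w ∈ words A m ] f (x ∷ w)  ≡⟨ ∑-cong A (λ x → ∑-words-cong A m (λ w |w| → f≗g (x ∷ w) (cong suc |w|))) ⟩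
  ∑[ x ∈ A ] ∑[ w ∈ words A m ] g (x ∷ w)  ≡⟨ ∑-words-suc A m g ⟨
  ∑ (words A (suc m)) g                    ∎
  where open ≡-Reasoning

isArrangementᵇ : List ℕ → List ℕ → Bool
isArrangementᵇ R [] = true
isArrangementᵇ R (x ∷ w) = x ∈ᵇ R ∧ isArrangementᵇ (remove x R) w

∑-words-arrangements : ∀ A R m (g : List ℕ → ℕ) → Distinct A → Distinct R → R ⊆ᵇ A →
  ∑[ w ∈ words A m ] (⟦ isArrangementᵇ R w ⟧ * g w) ≡ ∑Arr R m (λ _ w → g w)
∑-words-arrangements A R zero g _ _ _ = trans (+-identityʳ _) (+-identityʳ (g []))
∑-words-arrangements A R (suc m) g A-distinct R-distinct R⊆A = begin
  ∑[ w ∈ words A (suc m) ] (⟦ isArrangementᵇ R w ⟧ * g w)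
    ≡⟨ ∑-words-suc A m _ ⟩
  ∑[ x ∈ A ] ∑[ w ∈ words A m ] (⟦ x ∈ᵇ R ∧ isArrangementᵇ (remove x R) w ⟧ * g (x ∷ w))
    ≡⟨ ∑-cong A (λ x → trans (∑-cong (words A m) (λ w → split-∧ (x ∈ᵇ R) _ (g (x ∷ w))))
                             (∑-*ˡ (words A m) ⟦ x ∈ᵇ R ⟧ _)) ⟩
  ∑[ x ∈ A ] (⟦ x ∈ᵇ R ⟧ * ∑[ w ∈ words A m ] (⟦ isArrangementᵇ (remove x R) w ⟧ * g (x ∷ w)))
    ≡⟨ ∑-cong A (λ x → cong (⟦ x ∈ᵇ R ⟧ *_) (∑-words-arrangements A (remove x R) m (λ w → g (x ∷ w))
                          A-distinct (Distinct-remove x R R-distinct) (λ y y∈ → R⊆A y (∈ᵇ-remove⁻ y x R y∈)))) ⟩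
  ∑[ x ∈ A ] (⟦ x ∈ᵇ R ⟧ * ∑Arr (remove x R) m (λ _ w → g (x ∷ w)))
    ≡⟨ ∑-restrict A R _ A-distinct R-distinct R⊆A ⟩
  ∑Arr R (suc m) (λ _ w → g w) ∎
  where
  open ≡-Reasoning
  split-∧ : ∀ a b c → ⟦ a ∧ b ⟧ * c ≡ ⟦ a ⟧ * (⟦ b ⟧ * c)
  split-∧ a b c = trans (cong (_* c) (⟦∧⟧ a b)) (*-assoc ⟦ a ⟧ ⟦ b ⟧ c)

countᵇ-∷-≢ : ∀ {i y} w → i ≢ y → countᵇ i (y ∷ w) ≡ countᵇ i w
countᵇ-∷-≢ {i} {y} w i≢y with i ≡ᵇ y | ≡ᵇ-reflects-≡ i y
... | true | ofʸ i≡y = contradiction i≡y i≢y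
... | false | _ = refl

countᵇ-∷ : ∀ i y w → countᵇ i (y ∷ w) ≡ ⟦ i ≡ᵇ y ⟧ + countᵇ i w
countᵇ-∷ i y w with i ≡ᵇ y
... | true = refl
... | false = refl

countᵇ-∉ᵇ : ∀ x w → x ∈ᵇ w ≡ false → countᵇ x w ≡ 0
countᵇ-∉ᵇ x [] _ = refl
countᵇ-∉ᵇ x (y ∷ w) x∉ with ∉ᵇ-∷⁻ {xs = w} x∉
... | x≢y , x∉w = trans (countᵇ-∷-≢ w x≢y) (countᵇ-∉ᵇ x w x∉w)

∑-≡ᵇ≤1 : ∀ R y → Distinct R → ∑[ i ∈ R ] ⟦ i ≡ᵇ y ⟧ ≤ 1
∑-≡ᵇ≤1 [] y _ = z≤n
∑-≡ᵇ≤1 (r ∷ R) y (r∉R , R-distinct) with r ≡ᵇ y | ≡ᵇ-reflects-≡ r y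
... | false | _ = ∑-≡ᵇ≤1 R y R-distinct
... | true | ofʸ refl = ≤-reflexive (cong suc (trans (∑-cong-∈ᵇ R none) (∑-zero R)))
  where
  none : ∀ i → i ∈ᵇ R ≡ true → ⟦ i ≡ᵇ r ⟧ ≡ 0
  none i i∈R with i ≡ᵇ r | ≡ᵇ-reflects-≡ i r
  ... | false | _ = refl
  ... | true | ofʸ refl with () ← trans (sym i∈R) r∉R

∑-countᵇ≤length : ∀ R w → Distinct R → ∑[ i ∈ R ] countᵇ i w ≤ length w
∑-countᵇ≤length R [] _ = ≤-reflexive (∑-zero R)
∑-countᵇ≤length R (y ∷ w) R-distinct = begin
  ∑[ i ∈ R ] countᵇ i (y ∷ w)                         ≡⟨ ∑-cong R (λ i → countᵇ-∷ i y w) ⟩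
  ∑[ i ∈ R ] (⟦ i ≡ᵇ y ⟧ + countᵇ i w)                ≡⟨ ∑-distrib-+ R _ _ ⟩
  ∑[ i ∈ R ] ⟦ i ≡ᵇ y ⟧ + ∑[ i ∈ R ] countᵇ i w       ≤⟨ +-mono-≤ (∑-≡ᵇ≤1 R y R-distinct) (∑-countᵇ≤length R w R-distinct) ⟩
  suc (length w)                                      ∎
  where open ≤-Reasoning

allᵇ-cong-∈ᵇ : ∀ R {p q : ℕ → Bool} → (∀ i → i ∈ᵇ R ≡ true → p i ≡ q i) → allᵇ p R ≡ allᵇ q R
allᵇ-cong-∈ᵇ [] _ = refl
allᵇ-cong-∈ᵇ (r ∷ R) p≗q = cong₂ _∧_ (p≗q r (∈ᵇ-here r R)) (allᵇ-cong-∈ᵇ R (λ i i∈ → p≗q i (∈ᵇ-there i r R i∈)))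

allᵇ-remove : ∀ (p : ℕ → Bool) x R → x ∈ᵇ R ≡ true → allᵇ p R ≡ p x ∧ allᵇ p (remove x R)
allᵇ-remove p x (r ∷ R) x∈ with x ≡ᵇ r | ≡ᵇ-reflects-≡ x r
... | true | ofʸ refl = refl
... | false | _ rewrite allᵇ-remove p x R x∈ = ∧-swapˡ (p r) (p x) _
  where
  ∧-swapˡ : ∀ a b c → a ∧ (b ∧ c) ≡ b ∧ (a ∧ c)
  ∧-swapˡ true b c = refl
  ∧-swapˡ false true c = refl
  ∧-swapˡ false false c = refl

allᵇ-countᵇ≡1 : ∀ R w → allᵇ (λ i → countᵇ i w ≡ᵇ 1) R ≡ true → ∑[ i ∈ R ] countᵇ i w ≡ length R
allᵇ-countᵇ≡1 [] w _ = refl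
allᵇ-countᵇ≡1 (r ∷ R) w all≡1 with countᵇ r w ≡ᵇ 1 | ≡ᵇ-reflects-≡ (countᵇ r w) 1
... | true | ofʸ count≡1 = cong₂ _+_ count≡1 (allᵇ-countᵇ≡1 R w all≡1)

isArrangementᵇ-⊆ : ∀ R w → isArrangementᵇ R w ≡ true → w ⊆ᵇ R
isArrangementᵇ-⊆ R (x ∷ w) arr y y∈ with x ∈ᵇ R in x∈R | y ≡ᵇ x | ≡ᵇ-reflects-≡ y x
... | true | true | ofʸ refl = x∈R
... | true | false | _ = ∈ᵇ-remove⁻ y x R (isArrangementᵇ-⊆ (remove x R) w arr y y∈)

allᵇ-countᵇ≡1-foreign : ∀ R x w → Distinct R → x ∈ᵇ R ≡ false → length (x ∷ w) ≡ length R →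
  allᵇ (λ i → countᵇ i (x ∷ w) ≡ᵇ 1) R ≡ false
allᵇ-countᵇ≡1-foreign R x w R-distinct x∉R |x∷w| with allᵇ (λ i → countᵇ i (x ∷ w) ≡ᵇ 1) R in all≡1
... | false = refl
... | true = contradiction pigeonhole (1+n≰n {length w})
  where
  ≢x : ∀ i → i ∈ᵇ R ≡ true → i ≢ x
  ≢x i i∈ refl with () ← trans (sym i∈) x∉R
  pigeonhole : suc (length w) ≤ length w
  pigeonhole = begin
    suc (length w)              ≡⟨ |x∷w| ⟩
    length R                    ≡⟨ allᵇ-countᵇ≡1 R (x ∷ w) all≡1 ⟨
    ∑[ i ∈ R ] countᵇ i (x ∷ w) ≡⟨ ∑-cong-∈ᵇ R (λ i i∈ → countᵇ-∷-≢ w (≢x i i∈)) ⟩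
    ∑[ i ∈ R ] countᵇ i w       ≤⟨ ∑-countᵇ≤length R w R-distinct ⟩
    length w                    ∎
    where open ≤-Reasoning

allᵇ-countᵇ≡1≡isArrangementᵇ : ∀ R w → Distinct R → length w ≡ length R →
  allᵇ (λ i → countᵇ i w ≡ᵇ 1) R ≡ isArrangementᵇ R w
allᵇ-countᵇ≡1≡isArrangementᵇ [] [] _ _ = refl
allᵇ-countᵇ≡1≡isArrangementᵇ R (x ∷ w) R-distinct |x∷w| with x ∈ᵇ R in x∈R
... | true = begin
  allᵇ (λ i → countᵇ i (x ∷ w) ≡ᵇ 1) R
    ≡⟨ allᵇ-remove _ x R x∈R ⟩
  (countᵇ x (x ∷ w) ≡ᵇ 1) ∧ allᵇ (λ i → countᵇ i (x ∷ w) ≡ᵇ 1) R∖x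
    ≡⟨ cong₂ _∧_ (cong (_≡ᵇ 1) (countᵇ-∷ x x w)) (allᵇ-cong-∈ᵇ R∖x (λ i i∈ → cong (_≡ᵇ 1) (countᵇ-∷-≢ w (≢x i i∈)))) ⟩
  (⟦ x ≡ᵇ x ⟧ + countᵇ x w ≡ᵇ 1) ∧ allᵇ (λ i → countᵇ i w ≡ᵇ 1) R∖x
    ≡⟨ cong₂ _∧_ (cong (λ b → ⟦ b ⟧ + countᵇ x w ≡ᵇ 1) (≡ᵇ-refl x)) 
                 (allᵇ-countᵇ≡1≡isArrangementᵇ R∖x w (Distinct-remove x R R-distinct) |w|) ⟩
  (countᵇ x w ≡ᵇ 0) ∧ isArrangementᵇ R∖x w
    ≡⟨ x-fresh ⟩
  isArrangementᵇ R∖x w ∎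
  where
  open ≡-Reasoning
  R∖x = remove x R
  |w| : length w ≡ length R∖x
  |w| = suc-injective (trans |x∷w| (sym (length-remove x R x∈R)))
  ≢x : ∀ i → i ∈ᵇ R∖x ≡ true → i ≢ x
  ≢x i i∈ refl with () ← trans (sym i∈) (∉ᵇ-remove x R R-distinct)
  x-fresh : (countᵇ x w ≡ᵇ 0) ∧ isArrangementᵇ R∖x w ≡ isArrangementᵇ R∖x w
  x-fresh with isArrangementᵇ R∖x w in arr
  ... | false = ∧-zeroʳ _
  ... | true with x ∈ᵇ w in x∈w
  ...   | false rewrite countᵇ-∉ᵇ x w x∈w = refl
  ...   | true with () ← trans (sym (isArrangementᵇ-⊆ R∖x w arr x x∈w)) (∉ᵇ-remove x R R-distinct)
... | false = allᵇ-countᵇ≡1-foreign R x w R-distinct x∈R |x∷w|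

∉ᵇ-applyUpTo : ∀ n (g : ℕ → ℕ) a → (∀ i → g i ≢ a) → a ∈ᵇ applyUpTo g n ≡ false
∉ᵇ-applyUpTo zero g a _ = refl
∉ᵇ-applyUpTo (suc n) g a a∉g with a ≡ᵇ g 0 | ≡ᵇ-reflects-≡ a (g 0)
... | true | ofʸ a≡g0 = contradiction (sym a≡g0) (a∉g 0)
... | false | _ = ∉ᵇ-applyUpTo n (λ i → g (suc i)) a (λ i → a∉g (suc i))

Distinct-applyUpTo : ∀ n (g : ℕ → ℕ) → (∀ i j → g i ≡ g j → i ≡ j) → Distinct (applyUpTo g n)
Distinct-applyUpTo zero g _ = tt
Distinct-applyUpTo (suc n) g g-injective =
  ∉ᵇ-applyUpTo n (λ i → g (suc i)) (g 0) (λ i g[1+i]≡g0 → 0≢1+n (sym (g-injective (suc i) 0 g[1+i]≡g0))) ,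
  Distinct-applyUpTo n (λ i → g (suc i)) (λ i j g[1+i]≡g[1+j] → suc-injective (g-injective (suc i) (suc j) g[1+i]≡g[1+j]))

Distinct-oneTo : ∀ n → Distinct (oneTo n)
Distinct-oneTo n = subst Distinct (sym (map-upTo suc n)) (Distinct-applyUpTo n suc (λ _ _ → suc-injective))

length-oneTo : ∀ n → length (oneTo n) ≡ n
length-oneTo n = trans (length-map suc (upTo n)) (length-upTo n)

numUnimodal≡∑Arr : ∀ n lam → numUnimodal n lam ≡ ∑Arr (oneTo n) n (λ _ w → ⟦ λ-unimodalᵇ lam w ⟧)
numUnimodal≡∑Arr n lam = begin
  length (filter (λ w → T? (λ-unimodalᵇ lam w)) (Sₙ n))
    ≡⟨ length-filter (λ-unimodalᵇ lam) (Sₙ n) ⟩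
  ∑[ w ∈ Sₙ n ] ⟦ λ-unimodalᵇ lam w ⟧
    ≡⟨ ∑-filter (isPermᵇ n) (λ w → ⟦ λ-unimodalᵇ lam w ⟧) (words [n] n) ⟩
  ∑[ w ∈ words [n] n ] (⟦ isPermᵇ n w ⟧ * ⟦ λ-unimodalᵇ lam w ⟧)
    ≡⟨ ∑-words-cong [n] n (λ w |w| → cong (λ b → ⟦ b ⟧ * ⟦ λ-unimodalᵇ lam w ⟧)
         (allᵇ-countᵇ≡1≡isArrangementᵇ [n] w (Distinct-oneTo n) (trans |w| (sym (length-oneTo n))))) ⟩
  ∑[ w ∈ words [n] n ] (⟦ isArrangementᵇ [n] w ⟧ * ⟦ λ-unimodalᵇ lam w ⟧)
    ≡⟨ ∑-words-arrangements [n] [n] n _ (Distinct-oneTo n) (Distinct-oneTo n) (λ _ x∈ → x∈) ⟩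
  ∑Arr [n] n (λ _ w → ⟦ λ-unimodalᵇ lam w ⟧) ∎
  where
  open ≡-Reasoning
  [n] = oneTo n

corollary3p3 : (n : ℕ) → 1 ≤ n → (lam : List ℕ) → IsComposition n lam →
    numUnimodal n lam * product (map _! lam) ≡ (n !) * 2 ^ (n ∸ length lam)
corollary3p3 n _ lam (lam-positive , refl) =
  trans (cong (_* product (map _! lam)) (numUnimodal≡∑Arr n lam))
        (count-λ-unimodal lam lam-positive (oneTo n) (Distinct-oneTo n) (length-oneTo n))
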